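{- Let $q$ be a prime power, $n,k,r$ positive integers, $S$ a $(k-r)$-dimensional $\mathbb{F}_q$-subspace of $\mathbb{F}_{q^n}$ and $T$ an $r$-dimensional $\mathbb{F}_q$-subspace of $\mathbb{F}_{q^n}$, with $r\le k-r$. Let $U=S\times T$ and let $i$ be a positive integer. For each $i$ define $$\mathcal{I}_i(S,T)=\bigcup_{\substack{a_1,\ldots,a_i\in T\\ \langle a_1,\ldots,a_i\rangle_{\mathbb{F}_q}\in\mathcal{L}_i(T)}} a_1^{ -1}S\cap\cdots\cap a_i^{ -1}S,$$ where $\mathcal{L}_i(T)$ is the set of $i$-dimensional $\mathbb{F}_q$-subspaces of $T$ (so the union runs over $\mathbb{F}_q$-linearly independent $a_1,\dots,a_i\in T$). Then the set of points of weight at least $i$ in $L_U$, different from $\langle(1,0)\rangle_{\mathbb{F}_{q^n}}$, is $$\{\langle(\xi,1)\rangle_{\mathbb{F}_{q^n}} : \xi\in\mathcal{I}_i(S,T)\}.$$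
   Context: For an $\mathbb{F}_q$-subspace $U$ of $\mathbb{F}_{q^n}^2$, the $\mathbb{F}_q$-linear set $L_U=\{\langle u\rangle_{\mathbb{F}_{q^n}}: u\in U\setminus\{0\}\}\subseteq \mathrm{PG}(1,q^n)$ has rank $\dim_{\mathbb{F}_q}U$; the weight of a point $P=\langle v\rangle_{\mathbb{F}_{q^n}}$ is $w_{L_U}(P)=\dim_{\mathbb{F}_q}(U\cap\langle v\rangle_{\mathbb{F}_{q^n}})$. $S\times T=\{(s,t): s\in S,\ t\in T\}$, and $a^{ -1}S=\{a^{ -1}s : s\in S\}$. -}

module Defs where

open import Level using (Level; _⊔_)
open import Data.Nat using (ℕ; zero; suc; _≤_; _^_)
open import Data.Nat.Primality using (Prime)
open import Data.Fin using (Fin)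
import Data.Fin as F
open import Data.Product using (Σ; ∃; ∃-syntax; _×_; _,_)
open import Relation.Nullary using (¬_)
open import Relation.Binary.PropositionalEquality using (_≡_)
open import Algebra.Bundles using (CommutativeRing)

IsPrimePower : ℕ → Set
IsPrimePower q = Σ ℕ λ p → Σ ℕ λ e → Prime p × 1 ≤ e × q ≡ p ^ e

-- Abstract "vector space data": a carrier with equality, addition, zero and
-- an action of the field elements (restricted to the subfield F_q below).
record VecOps {c ℓ a e : Level} (K : Set c) : Set (c ⊔ Level.suc (a ⊔ e)) where
  field
    V     : Set a
    _≈ᵥ_  : V → V → Set e
    _+ᵥ_  : V → V → V
    0ᵥ    : V
    _·ᵥ_  : K → V → V

module FieldDefs {c ℓ : Level} (R : CommutativeRing c ℓ) where
  open CommutativeRing R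

  IsField : Set (c ⊔ ℓ)
  IsField = (¬ (1# ≈ 0#)) × (∀ x → ¬ (x ≈ 0#) → ∃[ y ] (y * x ≈ 1#))

  HasCard : {p : Level} → (Carrier → Set p) → ℕ → Set (c ⊔ ℓ ⊔ p)
  HasCard P m =
    Σ (Fin m → Carrier) λ en →
      (∀ j → P (en j)) ×
      (∀ j j' → en j ≈ en j' → j ≡ j') ×
      (∀ x → P x → ∃[ j ] (x ≈ en j))

  IsSubfield : {p : Level} → (Carrier → Set p) → Set (c ⊔ ℓ ⊔ p)
  IsSubfield F =
    (∀ x y → x ≈ y → F x → F y) ×
    F 0# × F 1# ×
    (∀ x y → F x → F y → F (x + y)) ×
    (∀ x y → F x → F y → F (x * y)) ×
    (∀ x → F x → F (- x)) ×
    (∀ x → F x → ¬ (x ≈ 0#) → ∃[ y ] (F y × y * x ≈ 1#))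

  K¹ : VecOps {c} {ℓ} {c} {ℓ} Carrier
  K¹ = record { V = Carrier ; _≈ᵥ_ = _≈_ ; _+ᵥ_ = _+_ ; 0ᵥ = 0# ; _·ᵥ_ = _*_ }

  _≈₂_ : Carrier × Carrier → Carrier × Carrier → Set ℓ
  (x , y) ≈₂ (x' , y') = (x ≈ x') × (y ≈ y')

  _·₂_ : Carrier → Carrier × Carrier → Carrier × Carrier
  λ' ·₂ (x , y) = (λ' * x , λ' * y)

  K² : VecOps {c} {ℓ} {c} {ℓ} Carrier
  K² = record { V = Carrier × Carrier ; _≈ᵥ_ = _≈₂_
              ; _+ᵥ_ = λ { (x , y) (x' , y') → (x + x' , y + y') }
              ; 0ᵥ = (0# , 0#) ; _·ᵥ_ = _·₂_ }

  module Lin {p a e : Level} (F : Carrier → Set p)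
             (W : VecOps {c} {ℓ} {a} {e} Carrier) where
    open VecOps W

    lincomb : {m : ℕ} → (Fin m → Carrier) → (Fin m → V) → V
    lincomb {zero} cs vs = 0ᵥ
    lincomb {suc m} cs vs = (cs F.zero ·ᵥ vs F.zero) +ᵥ lincomb (λ j → cs (F.suc j)) (λ j → vs (F.suc j))

    InSpan : {m : ℕ} → (Fin m → V) → V → Set (c ⊔ p ⊔ e)
    InSpan vs w = ∃[ cs ] ((∀ j → F (cs j)) × (w ≈ᵥ lincomb cs vs))

    LinIndep : {m : ℕ} → (Fin m → V) → Set (c ⊔ ℓ ⊔ p ⊔ e)
    LinIndep {m} vs = ∀ (cs : Fin m → Carrier) → (∀ j → F (cs j)) →
                      lincomb cs vs ≈ᵥ 0ᵥ → ∀ j → cs j ≈ 0#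

    IsSubspace : {w : Level} → (V → Set w) → Set (c ⊔ p ⊔ a ⊔ e ⊔ w)
    IsSubspace P = (∀ x y → x ≈ᵥ y → P x → P y) × P 0ᵥ ×
                   (∀ x y → P x → P y → P (x +ᵥ y)) ×
                   (∀ λ' x → F λ' → P x → P (λ' ·ᵥ x))

    HasDim : {w : Level} → (V → Set w) → ℕ → Set (c ⊔ ℓ ⊔ p ⊔ a ⊔ e ⊔ w)
    HasDim P d = Σ (Fin d → V) λ bs →
      (∀ j → P (bs j)) × LinIndep bs × (∀ x → P x → InSpan bs x)

  module Setup {p s t : Level} (F : Carrier → Set p)
               (S : Carrier → Set s) (T : Carrier → Set t) where
    module L1 = Lin F K¹
    module L2 = Lin F K²

    U : Carrier × Carrier → Set (s ⊔ t)
    U (x , y) = S x × T y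

    KLine : Carrier × Carrier → Carrier × Carrier → Set (c ⊔ ℓ)
    KLine v w = ∃[ λ' ] (w ≈₂ (λ' ·₂ v))

    WeightAtLeast : Carrier × Carrier → ℕ → Set (c ⊔ ℓ ⊔ p ⊔ s ⊔ t)
    WeightAtLeast v i = ∃[ d ] (L2.HasDim (λ w → U w × KLine v w) d × i ≤ d)

    SamePoint : Carrier × Carrier → Carrier × Carrier → Set (c ⊔ ℓ)
    SamePoint v w = ∃[ λ' ] ((¬ (λ' ≈ 0#)) × (v ≈₂ (λ' ·₂ w)))

    InInvMul : Carrier → Carrier → Set (c ⊔ ℓ ⊔ s)
    InInvMul a ξ = ∃[ s' ] (S s' × ∃[ b ] ((b * a ≈ 1#) × (ξ ≈ b * s')))

    InI : ℕ → Carrier → Set (c ⊔ ℓ ⊔ p ⊔ s ⊔ t)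
    InI i ξ = Σ (Fin i → Carrier) λ as →
      (∀ j → T (as j)) × L1.HasDim (L1.InSpan as) i × (∀ j → InInvMul (as j) ξ)

{-# OPTIONS --safe #-}
-- Write a point ⟨v⟩ ≠ ⟨(1,0)⟩ as ⟨(ξ,1)⟩. Then U ∩ ⟨(ξ,1)⟩ = {(ξa, a) : a ∈ T, ξa ∈ S}, so the
-- weight of ⟨(ξ,1)⟩ is the dimension of T ∩ ξ⁻¹S; and for a ≠ 0, ξ ∈ a⁻¹S iff ξa ∈ S, so
-- ξ ∈ 𝓘ᵢ(S,T) says exactly that T ∩ ξ⁻¹S contains i independent vectors. A weight is witnessed
-- by an explicit basis, so for the converse the i vectors are extended greedily to a basis of
-- T ∩ ξ⁻¹S by running through an enumeration of 𝔽_{qⁿ}; span membership is decidable because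
-- 𝔽_q is finite.
module Submission where

open import Defs
open import Level using (Level; _⊔_)
open import Data.Nat as ℕ using (ℕ; _≤_; _^_; _∸_; _≤′_; ≤′-refl; ≤′-step)
open import Data.Nat.Properties using (≤-refl; ≤-trans; n≤1+n; ≤⇒≤′)
open import Data.Fin using (Fin; zero; suc; _≟_)
open import Data.Fin.Properties using (any?)
open import Data.Vec.Functional using (Vector; _∷_; head; tail)
open import Data.Product using (Σ-syntax; ∃-syntax; _×_; _,_; proj₁; proj₂)
open import Data.Empty using (⊥-elim)
open import Function using (_∘_; id; const)
open import Function.Bundles using (_⇔_; mk⇔)
open import Relation.Nullary using (¬_; Dec; yes; no)
open import Relation.Nullary.Decidable using (map′; _×-dec_)
open import Relation.Binary.PropositionalEquality as ≡ using (_≡_)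
open import Algebra.Bundles using (CommutativeRing)

module _ {c ℓ : Level} (R : CommutativeRing c ℓ) where
  open CommutativeRing R hiding (zero)
  open FieldDefs R
  open import Relation.Binary.Reasoning.Setoid setoid
  open import Algebra.Properties.Ring ring using (-‿distribˡ-*; -‿distribʳ-*)
  open import Algebra.Properties.Group +-group using (inverseˡ-unique; //-rightDividesˡ; //-rightDividesʳ)
  open import Algebra.Properties.CommutativeSemigroup *-commutativeSemigroup using (x∙yz≈y∙xz; x∙yz≈z∙xy)

  x≈y+z⇒x-y≈z : ∀ {x y z} → x ≈ y + z → x - y ≈ z
  x≈y+z⇒x-y≈z {x} {y} {z} x≈y+z = begin
    x - y        ≈⟨ +-congʳ (trans x≈y+z (+-comm y z)) ⟩
    (z + y) - y  ≈⟨ //-rightDividesʳ y z ⟩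
    z            ∎

  x-y≈z⇒x≈y+z : ∀ {x y z} → x - y ≈ z → x ≈ y + z
  x-y≈z⇒x≈y+z {x} {y} {z} x-y≈z = begin
    x            ≈⟨ //-rightDividesˡ y x ⟨
    (x - y) + y  ≈⟨ +-congʳ x-y≈z ⟩
    z + y        ≈⟨ +-comm z y ⟩
    y + z        ∎

  inverse-cancel : ∀ {b c} a → b * c ≈ 1# → b * (c * a) ≈ a
  inverse-cancel {b} {c} a bc≈1 = begin
    b * (c * a)  ≈⟨ *-assoc b c a ⟨
    (b * c) * a  ≈⟨ *-congʳ bc≈1 ⟩
    1# * a       ≈⟨ *-identityˡ a ⟩
    a            ∎

  HasCard⇒≈-dec : ∀ {N} → HasCard (λ _ → Carrier) N → ∀ x y → Dec (x ≈ y)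
  HasCard⇒≈-dec (en , _ , en-injective , en-onto) x y with en-onto x x | en-onto y y
  ... | j , x≈ | k , y≈ = map′ same-index⇒≈ ≈⇒same-index (j ≟ k)
    where
    same-index⇒≈ : j ≡ k → x ≈ y
    same-index⇒≈ j≡k = trans x≈ (trans (reflexive (≡.cong en j≡k)) (sym y≈))
    ≈⇒same-index : x ≈ y → j ≡ k
    ≈⇒same-index x≈y = en-injective j k (trans (sym x≈) (trans x≈y y≈))

  δ : ∀ {m} → Fin m → Fin m → Carrier
  δ zero    zero    = 1#
  δ zero    (suc _) = 0#
  δ (suc _) zero    = 0#
  δ (suc j) (suc k) = δ j k

  δ-diag : ∀ {m} (j : Fin m) → δ j j ≈ 1#
  δ-diag zero    = refl
  δ-diag (suc j) = δ-diag j

  module Subfield {p : Level} (F : Carrier → Set p) (F-subfield : IsSubfield F) where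
    open Lin F K¹

    private
      F-0 : F 0#
      F-0 = proj₁ (proj₂ F-subfield)

      F-1 : F 1#
      F-1 = proj₁ (proj₂ (proj₂ F-subfield))

      F-* : ∀ x y → F x → F y → F (x * y)
      F-* = proj₁ (proj₂ (proj₂ (proj₂ (proj₂ F-subfield))))

      F-neg : ∀ x → F x → F (- x)
      F-neg = proj₁ (proj₂ (proj₂ (proj₂ (proj₂ (proj₂ F-subfield)))))

      F-inverse : ∀ x → F x → ¬ (x ≈ 0#) → ∃[ y ] (F y × y * x ≈ 1#)
      F-inverse = proj₂ (proj₂ (proj₂ (proj₂ (proj₂ (proj₂ F-subfield)))))

    δ-∈F : ∀ {m} (j k : Fin m) → F (δ j k)
    δ-∈F zero    zero    = F-1
    δ-∈F zero    (suc _) = F-0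
    δ-∈F (suc _) zero    = F-0
    δ-∈F (suc j) (suc k) = δ-∈F j k

    lincomb-cong : ∀ {m} {cs cs′ fs fs′ : Vector Carrier m} →
                   (∀ j → cs j ≈ cs′ j) → (∀ j → fs j ≈ fs′ j) → lincomb cs fs ≈ lincomb cs′ fs′
    lincomb-cong {ℕ.zero}  cs≈ fs≈ = refl
    lincomb-cong {ℕ.suc m} cs≈ fs≈ =
      +-cong (*-cong (cs≈ zero) (fs≈ zero)) (lincomb-cong (cs≈ ∘ suc) (fs≈ ∘ suc))

    lincomb-zero : ∀ {m} (fs : Vector Carrier m) → lincomb (λ _ → 0#) fs ≈ 0#
    lincomb-zero {ℕ.zero}  fs = refl
    lincomb-zero {ℕ.suc m} fs = trans (+-cong (zeroˡ (head fs)) (lincomb-zero (tail fs))) (+-identityˡ 0#)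

    lincomb-δ : ∀ {m} (j : Fin m) (fs : Vector Carrier m) → lincomb (δ j) fs ≈ fs j
    lincomb-δ zero    fs = trans (+-cong (*-identityˡ (head fs)) (lincomb-zero (tail fs))) (+-identityʳ (head fs))
    lincomb-δ (suc j) fs = trans (+-cong (zeroˡ (head fs)) (lincomb-δ j (tail fs))) (+-identityˡ (fs (suc j)))

    lincomb-scale-vectors : ∀ {m} a (cs fs : Vector Carrier m) → lincomb cs (λ j → a * fs j) ≈ a * lincomb cs fs
    lincomb-scale-vectors {ℕ.zero}  a cs fs = sym (zeroʳ a)
    lincomb-scale-vectors {ℕ.suc m} a cs fs =
      trans (+-cong (x∙yz≈y∙xz (head cs) a (head fs)) (lincomb-scale-vectors a (tail cs) (tail fs)))
            (sym (distribˡ a _ _))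

    lincomb-scale-coeffs : ∀ {m} a (cs fs : Vector Carrier m) → lincomb (λ j → a * cs j) fs ≈ a * lincomb cs fs
    lincomb-scale-coeffs {ℕ.zero}  a cs fs = sym (zeroʳ a)
    lincomb-scale-coeffs {ℕ.suc m} a cs fs =
      trans (+-cong (*-assoc a _ _) (lincomb-scale-coeffs a (tail cs) (tail fs))) (sym (distribˡ a _ _))

    ∈-span : ∀ {m} (fs : Vector Carrier m) j → InSpan fs (fs j)
    ∈-span fs j = δ j , δ-∈F j , sym (lincomb-δ j fs)

    InSpan-∷ : ∀ {m} {fs : Vector Carrier m} {a x} → InSpan fs x → InSpan (a ∷ fs) x
    InSpan-∷ {a = a} (cs , cs∈F , x≈) =
      0# ∷ cs , (λ { zero → F-0 ; (suc j) → cs∈F j }) , trans x≈ (sym (trans (+-congʳ (zeroˡ a)) (+-identityˡ _)))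

    lincomb-∈ : ∀ {w} {P : Carrier → Set w} → IsSubspace P → ∀ {m} {cs fs : Vector Carrier m} →
                (∀ j → F (cs j)) → (∀ j → P (fs j)) → P (lincomb cs fs)
    lincomb-∈ (_ , P-0 , _ , _) {ℕ.zero} cs∈F fs∈P = P-0
    lincomb-∈ P-subspace@(_ , _ , P-+ , P-·) {ℕ.suc m} cs∈F fs∈P =
      P-+ _ _ (P-· _ _ (cs∈F zero) (fs∈P zero)) (lincomb-∈ P-subspace (cs∈F ∘ suc) (fs∈P ∘ suc))

    span-⊆ : ∀ {w} {P : Carrier → Set w} → IsSubspace P → ∀ {m} {fs : Vector Carrier m} →
             (∀ j → P (fs j)) → ∀ {x} → InSpan fs x → P x
    span-⊆ P-subspace fs∈P (cs , cs∈F , x≈) = proj₁ P-subspace _ _ (sym x≈) (lincomb-∈ P-subspace cs∈F fs∈P)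

    LinIndep⇒≉0 : ¬ (1# ≈ 0#) → ∀ {m} {fs : Vector Carrier m} → LinIndep fs → ∀ j → ¬ (fs j ≈ 0#)
    LinIndep⇒≉0 1≉0 {fs = fs} independent j fs-j≈0 =
      1≉0 (trans (sym (δ-diag j)) (independent (δ j) (δ-∈F j) (trans (lincomb-δ j fs) fs-j≈0) j))

    LinIndep-tail : ∀ {m} {fs : Vector Carrier (ℕ.suc m)} → LinIndep fs → LinIndep (tail fs)
    LinIndep-tail {fs = fs} independent cs cs∈F combination≈0 =
      independent (0# ∷ cs) (λ { zero → F-0 ; (suc j) → cs∈F j })
        (trans (+-cong (zeroˡ (head fs)) combination≈0) (+-identityˡ 0#)) ∘ suc

    record Independent {w} (W : Carrier → Set w) (m : ℕ) : Set (c ⊔ ℓ ⊔ p ⊔ w) where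
      field
        family       : Vector Carrier m
        family-∈     : ∀ j → W (family j)
        family-indep : LinIndep family

    open Independent

    Independent-tail : ∀ {w} {W : Carrier → Set w} {m} → Independent W (ℕ.suc m) → Independent W m
    Independent-tail A = record
      { family       = tail (family A)
      ; family-∈     = family-∈ A ∘ suc
      ; family-indep = LinIndep-tail {fs = family A} (family-indep A)
      }

    Independent-≤ : ∀ {w} {W : Carrier → Set w} {i d} → i ≤ d → Independent W d → Independent W i
    Independent-≤ = go ∘ ≤⇒≤′
      where
      go : ∀ {w} {W : Carrier → Set w} {i d} → i ≤′ d → Independent W d → Independent W i
      go ≤′-refl       A = A
      go (≤′-step i≤d) A = go i≤d (Independent-tail A)

    Independent⇒HasDim-span : ∀ {w} {W : Carrier → Set w} {m} (A : Independent W m) → HasDim (InSpan (family A)) m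
    Independent⇒HasDim-span A = family A , ∈-span (family A) , family-indep A , λ _ → id

    module Finite {N : ℕ} (R-finite : HasCard (λ _ → Carrier) N) {q : ℕ} (F-finite : HasCard F q) where
      private
        _≈?_ : ∀ x y → Dec (x ≈ y)
        _≈?_ = HasCard⇒≈-dec R-finite

        enumF : Vector Carrier q
        enumF = proj₁ F-finite

        enumF-∈ : ∀ j → F (enumF j)
        enumF-∈ = proj₁ (proj₂ F-finite)

        enumF-onto : ∀ x → F x → ∃[ j ] (x ≈ enumF j)
        enumF-onto = proj₂ (proj₂ (proj₂ F-finite))

      span? : ∀ {m} (fs : Vector Carrier m) x → Dec (InSpan fs x)
      span? {ℕ.zero} fs x = map′ (λ x≈0 → (λ ()) , (λ ()) , x≈0) (proj₂ ∘ proj₂) (x ≈? 0#)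
      span? {ℕ.suc m} fs x = map′ from to (any? λ j → span? (tail fs) (x - enumF j * head fs))
        where
        from : ∃[ j ] InSpan (tail fs) (x - enumF j * head fs) → InSpan fs x
        from (j , cs , cs∈F , x-cf≈) =
          enumF j ∷ cs , (λ { zero → enumF-∈ j ; (suc k) → cs∈F k }) , x-y≈z⇒x≈y+z x-cf≈
        to : InSpan fs x → ∃[ j ] InSpan (tail fs) (x - enumF j * head fs)
        to (cs , cs∈F , x≈) with enumF-onto (head cs) (cs∈F zero)
        ... | j , c≈ = j , tail cs , cs∈F ∘ suc , x≈y+z⇒x-y≈z (trans x≈ (+-congʳ (*-congʳ c≈)))

      HasDim⇒decidable : ∀ {w} {P : Carrier → Set w} {d} → IsSubspace P → HasDim P d → ∀ x → Dec (P x)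
      HasDim⇒decidable P-subspace (bs , bs∈P , _ , spans) x =
        map′ (span-⊆ P-subspace bs∈P) (spans x) (span? bs x)

      LinIndep-∷ : ∀ {m} {fs : Vector Carrier m} {a} → LinIndep fs → ¬ InSpan fs a → LinIndep (a ∷ fs)
      LinIndep-∷ {m} {fs} {a} independent a∉span cs cs∈F combination≈0 with head cs ≈? 0#
      ... | yes c≈0 = λ { zero → c≈0 ; (suc j) → independent (tail cs) (cs∈F ∘ suc) rest≈0 j }
        where
        rest≈0 : lincomb (tail cs) fs ≈ 0#
        rest≈0 = begin
          lincomb (tail cs) fs                ≈⟨ +-identityˡ _ ⟨
          0# + lincomb (tail cs) fs           ≈⟨ +-congʳ (trans (sym (zeroˡ a)) (*-congʳ (sym c≈0))) ⟩
          head cs * a + lincomb (tail cs) fs  ≈⟨ combination≈0 ⟩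
          0#                                  ∎
      ... | no c≉0 with F-inverse (head cs) (cs∈F zero) c≉0
      ... | b , b∈F , bc≈1 = ⊥-elim (a∉span (coeffs , coeffs∈F , a≈))
        where
        L : Carrier
        L = lincomb (tail cs) fs
        coeffs : Vector Carrier m
        coeffs j = - b * cs (suc j)
        coeffs∈F : ∀ j → F (coeffs j)
        coeffs∈F j = F-* _ _ (F-neg b b∈F) (cs∈F (suc j))
        a≈ : a ≈ lincomb coeffs fs
        a≈ = begin
          a                     ≈⟨ inverse-cancel a bc≈1 ⟨
          b * (head cs * a)     ≈⟨ *-congˡ (inverseˡ-unique _ _ combination≈0) ⟩
          b * - L               ≈⟨ -‿distribʳ-* b L ⟨
          - (b * L)             ≈⟨ -‿distribˡ-* b L ⟩
          - b * L               ≈⟨ lincomb-scale-coeffs (- b) (tail cs) fs ⟨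
          lincomb coeffs fs     ∎

      module _ {w} {W : Carrier → Set w} (W-subspace : IsSubspace W) (W? : ∀ x → Dec (W x)) where
        adjoin : ∀ {m} (A : Independent W m) x →
                 Σ[ m′ ∈ ℕ ] Σ[ B ∈ Independent W m′ ]
                   (m ≤ m′ × (∀ {y} → InSpan (family A) y → InSpan (family B) y) × (W x → InSpan (family B) x))
        adjoin A x with W? x | span? (family A) x
        ... | no x∉W  | _          = _ , A , ≤-refl , id , ⊥-elim ∘ x∉W
        ... | yes _   | yes x∈span = _ , A , ≤-refl , id , const x∈span
        ... | yes x∈W | no x∉span  = _ , B , n≤1+n _ , InSpan-∷ , const (∈-span (family B) zero)
          where
          B : Independent W _
          B = record
            { family       = x ∷ family A
            ; family-∈     = λ { zero → x∈W ; (suc j) → family-∈ A j }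
            ; family-indep = LinIndep-∷ (family-indep A) x∉span
            }

        saturate : ∀ {n m} (xs : Vector Carrier n) (A : Independent W m) →
                   Σ[ m′ ∈ ℕ ] Σ[ B ∈ Independent W m′ ] (m ≤ m′ × (∀ j → W (xs j) → InSpan (family B) (xs j)))
        saturate {ℕ.zero}  xs A = _ , A , ≤-refl , λ ()
        saturate {ℕ.suc n} xs A with saturate (tail xs) A
        ... | _ , A′ , m≤ , covers-tail with adjoin A′ (head xs)
        ... | _ , B , ≤m′ , grows , covers-head =
          _ , B , ≤-trans m≤ ≤m′ , λ { zero → covers-head ; (suc j) → grows ∘ covers-tail j }

        extend-to-basis : ∀ {m} → Independent W m → ∃[ d ] (HasDim W d × m ≤ d)
        extend-to-basis A with saturate (proj₁ R-finite) A
        ... | d , B , m≤d , covers = d , (family B , family-∈ B , family-indep B , spans) , m≤d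
          where
          spans : ∀ x → W x → InSpan (family B) x
          spans x x∈W with proj₂ (proj₂ (proj₂ R-finite)) x x
          ... | j , x≈ with covers j (proj₁ W-subspace _ _ x≈ x∈W)
          ... | cs , cs∈F , en-j≈ = cs , cs∈F , trans x≈ en-j≈

    module PointsOfLU (isField : IsField) {s t : Level} (S : Carrier → Set s) (T : Carrier → Set t)
                      (S-subspace : IsSubspace S) (T-subspace : IsSubspace T) where
      open Setup F S T

      private
        S-resp : ∀ {x y} → x ≈ y → S x → S y
        S-resp = proj₁ S-subspace _ _

        inverse : ∀ x → ¬ (x ≈ 0#) → ∃[ y ] (y * x ≈ 1#)
        inverse = proj₂ isField

      lincomb-pair : ∀ {m} (cs : Vector Carrier m) (bs : Vector (Carrier × Carrier) m) →
                     L2.lincomb cs bs ≡ (lincomb cs (proj₁ ∘ bs) , lincomb cs (proj₂ ∘ bs))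
      lincomb-pair {ℕ.zero}  cs bs = ≡.refl
      lincomb-pair {ℕ.suc m} cs bs rewrite lincomb-pair (tail cs) (tail bs) = ≡.refl

      LinIndep-snd⇒LinIndep : ∀ {m} {bs : Vector (Carrier × Carrier) m} → LinIndep (proj₂ ∘ bs) → L2.LinIndep bs
      LinIndep-snd⇒LinIndep {bs = bs} independent cs cs∈F combination≈0 =
        independent cs cs∈F (proj₂ (≡.subst (_≈₂ (0# , 0#)) (lincomb-pair cs bs) combination≈0))

      LinIndep⇒LinIndep-snd : ∀ {m ξ} {bs : Vector (Carrier × Carrier) m} →
                              (∀ j → proj₁ (bs j) ≈ ξ * proj₂ (bs j)) → L2.LinIndep bs → LinIndep (proj₂ ∘ bs)
      LinIndep⇒LinIndep-snd {ξ = ξ} {bs} on-graph independent cs cs∈F snd≈0 =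
        independent cs cs∈F (≡.subst (_≈₂ (0# , 0#)) (≡.sym (lincomb-pair cs bs)) (fst≈0 , snd≈0))
        where
        fst≈0 : lincomb cs (proj₁ ∘ bs) ≈ 0#
        fst≈0 = begin
          lincomb cs (proj₁ ∘ bs)                ≈⟨ lincomb-cong (λ _ → refl) on-graph ⟩
          lincomb cs (λ j → ξ * proj₂ (bs j))    ≈⟨ lincomb-scale-vectors ξ cs (proj₂ ∘ bs) ⟩
          ξ * lincomb cs (proj₂ ∘ bs)            ≈⟨ *-congˡ snd≈0 ⟩
          ξ * 0#                                 ≈⟨ zeroʳ ξ ⟩
          0#                                     ∎

      ≉∞⇒snd≉0 : ∀ {v} → ¬ (v ≈₂ (0# , 0#)) → ¬ SamePoint v (1# , 0#) → ¬ (proj₂ v ≈ 0#)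
      ≉∞⇒snd≉0 {x , y} v≉0 v≉∞ y≈0 =
        v≉∞ (x , (λ x≈0 → v≉0 (x≈0 , y≈0)) , sym (*-identityʳ x) , trans y≈0 (sym (zeroʳ x)))

      ≉∞⇒affine : ∀ {v} → ¬ (v ≈₂ (0# , 0#)) → ¬ SamePoint v (1# , 0#) → ∃[ ξ ] SamePoint v (ξ , 1#)
      ≉∞⇒affine {x , y} v≉0 v≉∞ with inverse y (≉∞⇒snd≉0 v≉0 v≉∞)
      ... | y⁻¹ , y⁻¹y≈1 =
        y⁻¹ * x , y , ≉∞⇒snd≉0 v≉0 v≉∞ , sym (inverse-cancel x (trans (*-comm y y⁻¹) y⁻¹y≈1)) , sym (*-identityʳ y)

      affine⇒≉∞ : ∀ {v ξ} → SamePoint v (ξ , 1#) → ¬ SamePoint v (1# , 0#)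
      affine⇒≉∞ {x , y} (μ , μ≉0 , _ , y≈μ1) (λ′ , _ , _ , y≈λ′0) = μ≉0 (begin
        μ         ≈⟨ *-identityʳ μ ⟨
        μ * 1#    ≈⟨ y≈μ1 ⟨
        y         ≈⟨ y≈λ′0 ⟩
        λ′ * 0#   ≈⟨ zeroʳ λ′ ⟩
        0#        ∎)

      onLine⇒graph : ∀ {v ξ} → SamePoint v (ξ , 1#) → ∀ {w} → KLine v w → proj₁ w ≈ ξ * proj₂ w
      onLine⇒graph {x , y} {ξ} (μ , _ , x≈μξ , y≈μ1) {w₁ , w₂} (λ′ , w₁≈λ′x , w₂≈λ′y) = begin
        w₁                  ≈⟨ w₁≈λ′x ⟩
        λ′ * x              ≈⟨ *-congˡ x≈μξ ⟩
        λ′ * (μ * ξ)        ≈⟨ x∙yz≈z∙xy λ′ μ ξ ⟩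
        ξ * (λ′ * μ)        ≈⟨ *-congˡ (*-congˡ (trans (sym (*-identityʳ μ)) (sym y≈μ1))) ⟩
        ξ * (λ′ * y)        ≈⟨ *-congˡ w₂≈λ′y ⟨
        ξ * w₂              ∎

      graph-onLine : ∀ {v ξ} → SamePoint v (ξ , 1#) → ∀ a → KLine v (ξ * a , a)
      graph-onLine {x , y} {ξ} (μ , μ≉0 , x≈μξ , y≈μ1) a with inverse μ μ≉0
      ... | μ⁻¹ , μ⁻¹μ≈1 = a * μ⁻¹ , fst≈ , snd≈
        where
        rescale : ∀ z → (a * μ⁻¹) * (μ * z) ≈ a * z
        rescale z = trans (*-assoc a μ⁻¹ _) (*-congˡ (inverse-cancel z μ⁻¹μ≈1))
        fst≈ : ξ * a ≈ (a * μ⁻¹) * x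
        fst≈ = trans (*-comm ξ a) (trans (sym (rescale ξ)) (*-congˡ (sym x≈μξ)))
        snd≈ : a ≈ (a * μ⁻¹) * y
        snd≈ = trans (sym (*-identityʳ a)) (trans (sym (rescale 1#)) (*-congˡ (sym y≈μ1)))

      -- Fibre ξ = T ∩ ξ⁻¹S, which a ↦ (ξa , a) maps isomorphically onto U ∩ ⟨(ξ , 1)⟩.
      Fibre : Carrier → Carrier → Set (s ⊔ t)
      Fibre ξ a = T a × S (ξ * a)

      Fibre-subspace : ∀ ξ → IsSubspace (Fibre ξ)
      Fibre-subspace ξ = closed S-subspace T-subspace
        where
        closed : IsSubspace S → IsSubspace T → IsSubspace (Fibre ξ)
        closed (_ , S-0 , S-+ , S-·) (T-resp , T-0 , T-+ , T-·) =
          (λ a b a≈b (a∈T , ξa∈S) → T-resp a b a≈b a∈T , S-resp (*-congˡ a≈b) ξa∈S)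
          , (T-0 , S-resp (sym (zeroʳ ξ)) S-0)
          , (λ a b (a∈T , ξa∈S) (b∈T , ξb∈S) →
               T-+ a b a∈T b∈T , S-resp (sym (distribˡ ξ a b)) (S-+ _ _ ξa∈S ξb∈S))
          , (λ c a c∈F (a∈T , ξa∈S) → T-· c a c∈F a∈T , S-resp (x∙yz≈y∙xz c ξ a) (S-· c _ c∈F ξa∈S))

      InInvMul⇒Fibre : ∀ {a ξ} → T a → InInvMul a ξ → Fibre ξ a
      InInvMul⇒Fibre {a} {ξ} a∈T (s′ , s′∈S , b , ba≈1 , ξ≈bs′) = a∈T , S-resp (sym ξa≈s′) s′∈S
        where
        ξa≈s′ : ξ * a ≈ s′
        ξa≈s′ = trans (*-comm ξ a) (trans (*-congˡ ξ≈bs′) (inverse-cancel s′ (trans (*-comm a b) ba≈1)))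

      Fibre⇒InInvMul : ∀ {a ξ} → ¬ (a ≈ 0#) → Fibre ξ a → InInvMul a ξ
      Fibre⇒InInvMul {a} {ξ} a≉0 (_ , ξa∈S) with inverse a a≉0
      ... | b , ba≈1 = ξ * a , ξa∈S , b , ba≈1 , sym (trans (*-congˡ (*-comm ξ a)) (inverse-cancel ξ ba≈1))

      InI⇒Independent : ∀ {i ξ} → InI i ξ → Independent (Fibre ξ) i
      InI⇒Independent {ξ = ξ} (as , as∈T , (bs , bs∈span , bs-indep , _) , ξ∈as⁻¹S) = record
        { family       = bs
        ; family-∈     = span-⊆ (Fibre-subspace ξ) (λ j → InInvMul⇒Fibre (as∈T j) (ξ∈as⁻¹S j)) ∘ bs∈span
        ; family-indep = bs-indep
        }

      Independent⇒InI : ∀ {i ξ} → Independent (Fibre ξ) i → InI i ξ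
      Independent⇒InI A =
          family A
        , proj₁ ∘ family-∈ A
        , Independent⇒HasDim-span A
        , λ j → Fibre⇒InInvMul (LinIndep⇒≉0 (proj₁ isField) (family-indep A) j) (family-∈ A j)

      weight⇒Independent : ∀ {v ξ i} → SamePoint v (ξ , 1#) → WeightAtLeast v i →
                           ∃[ d ] (i ≤ d × Independent (Fibre ξ) d)
      weight⇒Independent {ξ = ξ} v∼ξ (d , (bs , bs∈ , bs-indep , _) , i≤d) = d , i≤d , record
        { family       = proj₂ ∘ bs
        ; family-∈     = λ j → proj₂ (proj₁ (bs∈ j)) , S-resp (on-graph j) (proj₁ (proj₁ (bs∈ j)))
        ; family-indep = LinIndep⇒LinIndep-snd on-graph bs-indep
        }
        where
        on-graph : ∀ j → proj₁ (bs j) ≈ ξ * proj₂ (bs j)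
        on-graph j = onLine⇒graph v∼ξ (proj₂ (bs∈ j))

      Fibre-basis⇒line-basis : ∀ {v ξ d} → SamePoint v (ξ , 1#) → HasDim (Fibre ξ) d →
                               L2.HasDim (λ w → U w × KLine v w) d
      Fibre-basis⇒line-basis {v} {ξ} {d} v∼ξ (fs , fs∈ , fs-indep , fs-spans) =
        graph , graph∈ , LinIndep-snd⇒LinIndep fs-indep , graph-spans
        where
        graph : Vector (Carrier × Carrier) d
        graph j = ξ * fs j , fs j
        graph∈ : ∀ j → U (graph j) × KLine v (graph j)
        graph∈ j = (proj₂ (fs∈ j) , proj₁ (fs∈ j)) , graph-onLine v∼ξ (fs j)
        graph-spans : ∀ w → U w × KLine v w → L2.InSpan graph w
        graph-spans (w₁ , w₂) ((w₁∈S , w₂∈T) , w∈⟨v⟩)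
          with fs-spans w₂ (w₂∈T , S-resp (onLine⇒graph v∼ξ w∈⟨v⟩) w₁∈S)
        ... | cs , cs∈F , w₂≈ = cs , cs∈F , ≡.subst ((w₁ , w₂) ≈₂_) (≡.sym (lincomb-pair cs graph)) (w₁≈ , w₂≈)
          where
          w₁≈ : w₁ ≈ lincomb cs (λ j → ξ * fs j)
          w₁≈ = trans (onLine⇒graph v∼ξ w∈⟨v⟩) (trans (*-congˡ w₂≈) (sym (lincomb-scale-vectors ξ cs fs)))

theorem3p2 : {c ℓ p s t : Level} (R : CommutativeRing c ℓ) →
    let open CommutativeRing R
        open FieldDefs R
    in IsField →
       (q n k r i : ℕ) → IsPrimePower q → 1 ≤ n → 1 ≤ k → 1 ≤ r → 1 ≤ i →
       HasCard (λ _ → Carrier) (q ^ n) →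
       (F : Carrier → Set p) → IsSubfield F → HasCard F q →
       (S : Carrier → Set s) → (T : Carrier → Set t) →
       Lin.IsSubspace F K¹ S → Lin.HasDim F K¹ S (k ∸ r) →
       Lin.IsSubspace F K¹ T → Lin.HasDim F K¹ T r →
       r ≤ k ∸ r →
       ∀ (v : Carrier × Carrier) → ¬ (v ≈₂ (0# , 0#)) →
       ((¬ Setup.SamePoint F S T v (1# , 0#)) × Setup.WeightAtLeast F S T v i)
         ⇔ (∃[ ξ ] (Setup.InI F S T i ξ × Setup.SamePoint F S T v (ξ , 1#)))
theorem3p2 R isField _ _ _ _ i _ _ _ _ _ R-finite F F-subfield F-finite S T S-subspace S-dim T-subspace T-dim _ v v≉0 =
  mk⇔ forward backward
  where
  open CommutativeRing R using (_*_; 0#; 1#)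
  open Subfield R F F-subfield
  open Finite R-finite F-finite
  open PointsOfLU isField S T S-subspace T-subspace
  open FieldDefs R using (module Setup)
  open Setup F S T using (SamePoint; WeightAtLeast; InI)

  forward : (¬ SamePoint v (1# , 0#)) × WeightAtLeast v i → ∃[ ξ ] (InI i ξ × SamePoint v (ξ , 1#))
  forward (v≉∞ , weight) with ≉∞⇒affine v≉0 v≉∞
  ... | ξ , v∼ξ with weight⇒Independent v∼ξ weight
  ... | _ , i≤d , A = ξ , Independent⇒InI (Independent-≤ i≤d A) , v∼ξ

  Fibre? : ∀ ξ a → Dec (Fibre ξ a)
  Fibre? ξ a = HasDim⇒decidable T-subspace T-dim a ×-dec HasDim⇒decidable S-subspace S-dim (ξ * a)

  backward : ∃[ ξ ] (InI i ξ × SamePoint v (ξ , 1#)) → (¬ SamePoint v (1# , 0#)) × WeightAtLeast v i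
  backward (ξ , ξ∈I , v∼ξ) with extend-to-basis (Fibre-subspace ξ) (Fibre? ξ) (InI⇒Independent ξ∈I)
  ... | d , basis , i≤d = affine⇒≉∞ v∼ξ , d , Fibre-basis⇒line-basis v∼ξ basis , i≤d
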